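{- Let $m,s,k$ be positive integers with $ms>1$, let $r=2ms-1$, and set \[ D:=m\left(2r^k+m\left(s-r^k\right)^2\right). \] Define $c_1,\dots,c_{3k-2}$ by $c_1=2mr^{k-1}-1$ and, for $1\le j\le k-1$, $c_{3j-1}=r^j-1$, $c_{3j}=1$, $c_{3j+1}=2mr^{k-1-j}-1$ (so the sequence is $2mr^{k-1}-1,\ r-1,1,2mr^{k-2}-1,\ r^2-1,1,2mr^{k-3}-1,\dots,r^{k-1}-1,1,2m-1$). Then $l(D)=6k-2$ and \[ \sqrt D=[m(r^k-s)+1;\overline{c_1,\dots,c_{3k-2},\,r^k-s,\,c_{3k-2},\dots,c_1,\,2m(r^k-s)+2}]. \]
   Context: For a positive non-square integer $D$, $l(D)$ denotes the length of the fundamental (shortest) period of the regular continued fraction expansion of $\sqrt D$. $[a_0;\overline{b_1,\dots,b_m}]$ denotes the regular continued fraction whose partial quotients after $a_0$ are the block $b_1,\dots,b_m$ repeated infinitely often. -}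

module Defs where

open import Data.Nat using (ℕ; zero; suc; _+_; _*_; _∸_; _^_; _≤_; _<_; _≤?_; _/_)
open import Data.Nat using (_%_)
open import Data.Nat.DivMod using (m%n<n)
open import Data.Bool using (Bool; true; false; if_then_else_; _∨_)
open import Data.List using (List; []; _∷_; _++_; reverse; length; concatMap; lookup; upTo)
open import Data.Fin using (Fin)
open import Data.Product using (Σ; _×_; _,_; ∃)
open import Relation.Nullary.Decidable using (⌊_⌋)
open import Relation.Binary.PropositionalEquality using (_≡_)
open import Relation.Nullary using (¬_)

NonSquare : ℕ → Set
NonSquare D = ¬ (∃ λ a → a * a ≡ D)

-- A complete quotient of √D is represented as (P + √D) / Q with P, Q ∈ ℕ, Q > 0.
-- "a ≤ (P + √D)/Q" is decided exactly: a*Q - P ≤ √D, i.e.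
-- either a*Q ≤ P, or (a*Q - P)² ≤ D.
leQI : ℕ → ℕ → ℕ → ℕ → Bool
leQI D P Q a = ⌊ a * Q ≤? P ⌋ ∨ ⌊ (a * Q ∸ P) * (a * Q ∸ P) ≤? D ⌋

searchDown : ℕ → ℕ → ℕ → ℕ → ℕ
searchDown D P Q zero = zero
searchDown D P Q (suc n) = if leQI D P Q (suc n) then suc n else searchDown D P Q n

-- floor of (P + √D)/Q  (for Q ≥ 1 it is ≤ P + D, which bounds the search)
floorQI : ℕ → ℕ → ℕ → ℕ
floorQI D P Q = searchDown D P Q (P + D)

-- exact division guarded against Q = 0 (never happens for non-square D)
divG : ℕ → ℕ → ℕ
divG n zero = zero
divG n (suc q) = n / suc q

-- state (P_i, Q_i) of x_i = (P_i + √D)/Q_i, starting from x_0 = √D,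
-- x_{i+1} = 1/(x_i - a_i) = (P' + √D)/Q' with P' = a_i Q_i - P_i, Q' = (D - P'²)/Q_i.
state : ℕ → ℕ → ℕ × ℕ
state D zero = 0 , 1
state D (suc i) with state D i
... | P , Q = let a = floorQI D P Q
                  P' = a * Q ∸ P
              in P' , divG (D ∸ P' * P') Q

cfSqrt : ℕ → ℕ → ℕ
cfSqrt D i with state D i
... | P , Q = floorQI D P Q

IsPeriod : ℕ → ℕ → Set
IsPeriod D p = ∀ n → 1 ≤ n → cfSqrt D (n + p) ≡ cfSqrt D n

PeriodLength : ℕ → ℕ → Set
PeriodLength D L = 1 ≤ L × IsPeriod D L × (∀ p → 1 ≤ p → IsPeriod D p → L ≤ p)

lookupMod : List ℕ → ℕ → ℕ
lookupMod [] i = 0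
lookupMod (x ∷ xs) i = lookup (x ∷ xs) (Data.Fin.fromℕ< (m%n<n i (suc (length xs))))

-- √D = [a0; overline{block}] : a_0 = a0 and a_{1+i} = block[i mod |block|]
HasExpansion : ℕ → ℕ → List ℕ → Set
HasExpansion D a0 block =
  cfSqrt D 0 ≡ a0 ×
  Σ (1 ≤ length block) λ _ →
    ∀ i → cfSqrt D (suc i) ≡ lookupMod block i

rOf : ℕ → ℕ → ℕ
rOf m s = 2 * m * s ∸ 1

DOf : ℕ → ℕ → ℕ → ℕ
DOf m s k = m * (2 * rOf m s ^ k + m * ((rOf m s ^ k ∸ s) * (rOf m s ^ k ∸ s)))

cSeq : ℕ → ℕ → ℕ → List ℕ
cSeq m s k = (2 * m * r ^ (k ∸ 1) ∸ 1) ∷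
  concatMap (λ j → (r ^ j ∸ 1) ∷ 1 ∷ (2 * m * r ^ (k ∸ 1 ∸ j) ∸ 1) ∷ []) (Data.List.map suc (upTo (k ∸ 1)))
  where r = rOf m s

blockOf : ℕ → ℕ → ℕ → List ℕ
blockOf m s k = cSeq m s k ++ ((rOf m s ^ k ∸ s) ∷ reverse (cSeq m s k) ++ (2 * m * (rOf m s ^ k ∸ s) + 2) ∷ [])

{-# OPTIONS --safe #-}

-- Put N = m(rᵏ − s) + 1. Then D = N² + r with 0 < r ≤ 2N, and T := 2N + r − 1 = 2m·rᵏ. Every factorisation T = q·v gives the
-- states α q = (N + r − q , q), β q = (N − 1 , q) and μ q v = (N + r − q , (q − r)(v − 1) + 1).
-- Whenever r·u·v = T, three steps of the algorithm lead from β (r u) through μ (r u) v and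
-- α (r v) to β u, with partial quotients v − 1, 1, u − 1. Each step is checked through its
-- floor condition P′ ≤ N < P′ + Q and the identities P′ + P = aQ and P′² + Q′Q = D (in ℤ).
-- With u = 2m·r^(k−1−j) and v = rʲ these steps give the triples of the sequence c; with u
-- and v exchanged they give the same triples reversed. Between the two halves, β (2m) goes to
-- β (rᵏ) with partial quotient rᵏ − s. The period then returns through (N , 1), whose partial
-- quotient is 2N, to (N , r), the state after the first step. All other partial quotients are
-- below 2N, so no shorter period exists.

module Submission where

open import Defs
open import Data.Product using (_×_; _,_)
open import Relation.Binary.PropositionalEquality

-- The hypotheses give the ℤ-values of the natural
-- numbers in a step, and r is eliminated through the factorisation q·v = 2n + 1 + r.
-- The module precedes the ℕ imports so that ℤ's operators can be used unqualified.
module ℤ-Identities where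

  open import Data.Integer using (ℤ; _+_; _-_; _*_; 1ℤ)
  open import Data.Integer.Tactic.RingSolver using (solve)
  open import Data.List using (_∷_; [])

  sum-identity : ∀ n q p {r P a : ℤ} → r ≡ q * p - n - n - 1ℤ → P ≡ n + 1ℤ + r - q → a ≡ p - 1ℤ →
                 n + P ≡ a * q
  sum-identity n q p refl refl refl = solve (n ∷ q ∷ p ∷ [])

  norm-identity : ∀ n q p {r : ℤ} → r ≡ q * p - n - n - 1ℤ → n * n + p * q ≡ (n + 1ℤ) * (n + 1ℤ) + r
  norm-identity n q p refl = solve (n ∷ q ∷ p ∷ [])

  β-norm-identity : ∀ n q v {r P′ M : ℤ} → r ≡ q * v - n - n - 1ℤ → P′ ≡ n + 1ℤ + r - q →
                    M ≡ (q - r) * (v - 1ℤ) + 1ℤ → P′ * P′ + M * q ≡ (n + 1ℤ) * (n + 1ℤ) + r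
  β-norm-identity n q v refl refl refl = solve (n ∷ q ∷ v ∷ [])

  μ-sum-identity : ∀ n q v {r P P′ Q′ M : ℤ} → r ≡ q * v - n - n - 1ℤ → Q′ ≡ r * v → P′ ≡ n + 1ℤ + r - Q′ →
                   P ≡ n + 1ℤ + r - q → M ≡ (q - r) * (v - 1ℤ) + 1ℤ → P′ + P ≡ 1ℤ * M
  μ-sum-identity n q v refl refl refl refl refl = solve (n ∷ q ∷ v ∷ [])

  μ-norm-identity : ∀ n q v {r P′ Q′ M : ℤ} → r ≡ q * v - n - n - 1ℤ → Q′ ≡ r * v → P′ ≡ n + 1ℤ + r - Q′ →
                    M ≡ (q - r) * (v - 1ℤ) + 1ℤ → P′ * P′ + Q′ * M ≡ (n + 1ℤ) * (n + 1ℤ) + r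
  μ-norm-identity n q v refl refl refl refl = solve (n ∷ q ∷ v ∷ [])

  μ-gap-identity : ∀ n q v r {P′ Q′ M W : ℤ} → Q′ ≡ r * v → P′ ≡ n + 1ℤ + r - Q′ →
                   M ≡ (q - r) * (v - 1ℤ) + 1ℤ → W ≡ (v - 1ℤ) * (q - (r + r)) → P′ + M ≡ 1ℤ + (n + 1ℤ) + W
  μ-gap-identity n q v r refl refl refl refl = solve (n ∷ q ∷ v ∷ r ∷ [])

  solve-for-r : ∀ {x n r : ℤ} → x ≡ n + (n + 1ℤ) + r → r ≡ x - n - n - 1ℤ
  solve-for-r {n = n} {r} refl = solve (n ∷ r ∷ [])

open ℤ-Identities

open import Data.Nat using (ℕ; zero; suc; _+_; _*_; _∸_; _^_; _≤_; _<_; _≤?_; _/_; _%_; z≤n; s≤s; z<s; >-nonZero)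
open import Data.Nat.Properties
open import Algebra.Properties.CommutativeSemigroup *-commutativeSemigroup using (x∙yz≈y∙xz; xy∙z≈xz∙y)
open import Data.Nat.DivMod using (m*n/n≡m; m%n<n; m≡m%n+[m/n]*n)
open import Data.Nat.Tactic.RingSolver using (solve; solve-∀)
open import Data.Integer using (+_; 1ℤ)
import Data.Integer as ℤ
import Data.Integer.Properties as ℤ
open import Data.Bool using (true; false; _∨_)
open import Data.Bool.Properties using (∨-zeroʳ)
open import Data.List using (List; []; _∷_; _++_; _∷ʳ_; length; lookup; reverse; concatMap; map; upTo)
open import Data.List.Properties
  using (++-assoc; ++-identityʳ; concatMap-++; concatMap-map; applyUpTo-∷ʳ; reverse-++; unfold-reverse;
         length-++; length-map; length-reverse; length-applyUpTo)
open import Data.List.Relation.Unary.All.Properties using (++⁺; ∷ʳ⁺; concat⁺; map⁺; applyUpTo⁺₁)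
open import Data.List.Relation.Unary.All as All using (All)
open import Data.List.Membership.Propositional.Properties using (∈-lookup)
open import Data.Fin using (Fin; toℕ; fromℕ<)
open import Data.Fin.Properties using (toℕ-fromℕ<)
open import Data.Sum using (inj₁; inj₂)
open import Relation.Nullary using (Dec; ¬_; yes; no)
open import Relation.Nullary.Decidable using (⌊_⌋; dec-true; dec-false; isYes≗does)

next : ℕ → ℕ × ℕ → ℕ × ℕ
next D (P , Q) = P′ , divG (D ∸ P′ * P′) Q
  where
  P′ : ℕ
  P′ = floorQI D P Q * Q ∸ P

quotient : ℕ → ℕ × ℕ → ℕ
quotient D (P , Q) = floorQI D P Q

state-suc : ∀ D i → state D (suc i) ≡ next D (state D i)
state-suc D i with state D i
... | P , Q = refl

cfSqrt≡quotient : ∀ D i → cfSqrt D i ≡ quotient D (state D i)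
cfSqrt≡quotient D i with state D i
... | P , Q = refl

Step : ℕ → ℕ × ℕ → ℕ → ℕ × ℕ → Set
Step D σ a σ′ = quotient D σ ≡ a × next D σ ≡ σ′

⌊⌋≡true : ∀ {A : Set} (a? : Dec A) → A → ⌊ a? ⌋ ≡ true
⌊⌋≡true a? a = trans (isYes≗does a?) (dec-true a? a)

⌊⌋≡false : ∀ {A : Set} (a? : Dec A) → ¬ A → ⌊ a? ⌋ ≡ false
⌊⌋≡false a? ¬a = trans (isYes≗does a?) (dec-false a? ¬a)

searchDown-≡ : ∀ {D P Q a} n → a ≤ n → leQI D P Q a ≡ true →
               (∀ {b} → a < b → leQI D P Q b ≡ false) → searchDown D P Q n ≡ a
searchDown-≡ zero z≤n _ _ = refl
searchDown-≡ (suc n) a≤1+n a-ok above-fails with m≤n⇒m<n∨m≡n a≤1+n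
... | inj₁ a<1+n rewrite above-fails a<1+n = searchDown-≡ n (≤-pred a<1+n) a-ok above-fails
... | inj₂ refl rewrite a-ok = refl

divG-* : ∀ m Q → 0 < Q → divG (m * Q) Q ≡ m
divG-* m (suc q) _ = m*n/n≡m m (suc q)

n≤n*n : ∀ n → n ≤ n * n
n≤n*n zero = z≤n
n≤n*n (suc n) = m≤m*n (suc n) (suc n)

module FloorSqrt {D N : ℕ} (N²≤D : N * N ≤ D) (D<[1+N]² : D < suc N * suc N) where

  leQI-true : ∀ {P Q b} → b * Q ≤ P + N → leQI D P Q b ≡ true
  leQI-true {P} {Q} {b} bQ≤P+N =
    trans (cong (⌊ b * Q ≤? P ⌋ ∨_) (⌊⌋≡true (d * d ≤? D) d²≤D)) (∨-zeroʳ ⌊ b * Q ≤? P ⌋)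
    where
    d : ℕ
    d = b * Q ∸ P
    d≤N : d ≤ N
    d≤N = ≤-trans (∸-monoˡ-≤ P bQ≤P+N) (≤-reflexive (m+n∸m≡n P N))
    d²≤D : d * d ≤ D
    d²≤D = ≤-trans (*-mono-≤ d≤N d≤N) N²≤D

  leQI-false : ∀ {P Q b} → P + N < b * Q → leQI D P Q b ≡ false
  leQI-false {P} {Q} {b} P+N<bQ =
    cong₂ _∨_ (⌊⌋≡false (b * Q ≤? P) (<⇒≱ (≤-<-trans (m≤m+n P N) P+N<bQ)))
              (⌊⌋≡false (d * d ≤? D) (<⇒≱ (<-≤-trans D<[1+N]² (*-mono-≤ 1+N≤d 1+N≤d))))
    where
    d : ℕ
    d = b * Q ∸ P
    1+N≤d : suc N ≤ d
    1+N≤d = ≤-trans (≤-reflexive (sym (m+n∸m≡n P (suc N))))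
                    (∸-monoˡ-≤ P (≤-trans (≤-reflexive (+-suc P N)) P+N<bQ))

  floorQI-≡ : ∀ {P Q a} → 0 < Q → a * Q ≤ P + N → P + N < suc a * Q → floorQI D P Q ≡ a
  floorQI-≡ {P} {Q} {a} 0<Q lower upper =
    searchDown-≡ (P + D) a≤P+D (leQI-true {P} {Q} {a} lower)
      (λ {b} a<b → leQI-false {P} {Q} {b} (<-≤-trans upper (*-monoˡ-≤ Q a<b)))
    where
    a≤P+D : a ≤ P + D
    a≤P+D = ≤-trans (m≤m*n a Q {{>-nonZero 0<Q}})
              (≤-trans lower (+-monoʳ-≤ P (≤-trans (n≤n*n N) N²≤D)))

  -- With P′ = aQ − P, the floor condition aQ ≤ P + N < (a + 1)Q reads P′ ≤ N < P′ + Q.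
  step : ∀ {P Q a P′ Q′} → P′ + P ≡ a * Q → P′ ≤ N → N < P′ + Q → P′ * P′ + Q′ * Q ≡ D →
         Step D (P , Q) a (P′ , Q′)
  step {P} {Q} {a} {P′} {Q′} sum P′≤N N<P′+Q norm = a≡ , cong₂ _,_ P″≡P′ Q″≡Q′
    where
    0<Q : 0 < Q
    0<Q = +-cancelˡ-< P′ 0 Q (≤-<-trans (≤-reflexive (+-identityʳ P′)) (≤-<-trans P′≤N N<P′+Q))
    lower : a * Q ≤ P + N
    lower = begin
      a * Q   ≡⟨ sum ⟨
      P′ + P  ≤⟨ +-monoˡ-≤ P P′≤N ⟩
      N + P   ≡⟨ +-comm N P ⟩
      P + N   ∎ where open ≤-Reasoning
    upper : P + N < suc a * Q
    upper = begin-strict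
      P + N         <⟨ +-monoʳ-< P N<P′+Q ⟩
      P + (P′ + Q)  ≡⟨ solve (P ∷ P′ ∷ Q ∷ []) ⟩
      Q + (P′ + P)  ≡⟨ cong (_+_ Q) sum ⟩
      suc a * Q     ∎ where open ≤-Reasoning
    a≡ : floorQI D P Q ≡ a
    a≡ = floorQI-≡ 0<Q lower upper
    P″≡P′ : floorQI D P Q * Q ∸ P ≡ P′
    P″≡P′ = begin
      floorQI D P Q * Q ∸ P ≡⟨ cong (λ x → x * Q ∸ P) a≡ ⟩
      a * Q ∸ P             ≡⟨ cong (_∸ P) sum ⟨
      P′ + P ∸ P            ≡⟨ m+n∸n≡m P′ P ⟩
      P′                    ∎ where open ≡-Reasoning
    Q″≡Q′ : divG (D ∸ (floorQI D P Q * Q ∸ P) * (floorQI D P Q * Q ∸ P)) Q ≡ Q′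
    Q″≡Q′ = begin
      divG (D ∸ (floorQI D P Q * Q ∸ P) * (floorQI D P Q * Q ∸ P)) Q
        ≡⟨ cong (λ x → divG (D ∸ x * x) Q) P″≡P′ ⟩
      divG (D ∸ P′ * P′) Q                 ≡⟨ cong (λ x → divG (x ∸ P′ * P′) Q) norm ⟨
      divG (P′ * P′ + Q′ * Q ∸ P′ * P′) Q  ≡⟨ cong (λ x → divG x Q) (m+n∸m≡n (P′ * P′) (Q′ * Q)) ⟩
      divG (Q′ * Q) Q                      ≡⟨ divG-* Q′ Q 0<Q ⟩
      Q′                                   ∎ where open ≡-Reasoning

data Run (D : ℕ) : ℕ × ℕ → List ℕ → ℕ × ℕ → Set where
  []  : ∀ {σ} → Run D σ [] σ
  _∷_ : ∀ {σ a σ′ as τ} → Step D σ a σ′ → Run D σ′ as τ → Run D σ (a ∷ as) τ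

infixr 5 _++ᴿ_

_++ᴿ_ : ∀ {D σ τ υ as bs} → Run D σ as τ → Run D τ bs υ → Run D σ (as ++ bs) υ
[]      ++ᴿ ρ′ = ρ′
(s ∷ ρ) ++ᴿ ρ′ = s ∷ (ρ ++ᴿ ρ′)

Step-state : ∀ {D σ a σ′} i → state D i ≡ σ → Step D σ a σ′ → state D (suc i) ≡ σ′
Step-state {D} i st (_ , next≡) = trans (state-suc D i) (trans (cong (next D) st) next≡)

Step-cfSqrt : ∀ {D σ a σ′} i → state D i ≡ σ → Step D σ a σ′ → cfSqrt D i ≡ a
Step-cfSqrt {D} i st (quotient≡ , _) = trans (cfSqrt≡quotient D i) (trans (cong (quotient D) st) quotient≡)

Run-state : ∀ {D σ as τ} i → state D i ≡ σ → Run D σ as τ → state D (i + length as) ≡ τ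
Run-state {D} i st []      = trans (cong (state D) (+-identityʳ i)) st
Run-state {D} i st (s ∷ ρ) = trans (cong (state D) (+-suc i _)) (Run-state (suc i) (Step-state i st s) ρ)

Run-cfSqrt : ∀ {D σ as τ} i → state D i ≡ σ → Run D σ as τ →
             ∀ (j : Fin (length as)) → cfSqrt D (i + toℕ j) ≡ lookup as j
Run-cfSqrt {D} i st (s ∷ ρ) Fin.zero    = trans (cong (cfSqrt D) (+-identityʳ i)) (Step-cfSqrt i st s)
Run-cfSqrt {D} i st (s ∷ ρ) (Fin.suc j) = trans (cong (cfSqrt D) (+-suc i (toℕ j))) (Run-cfSqrt (suc i) (Step-state i st s) ρ j)

concatMap-upTo-suc : ∀ (f : ℕ → List ℕ) K → concatMap f (upTo (suc K)) ≡ concatMap f (upTo K) ++ f K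
concatMap-upTo-suc f K = begin
  concatMap f (upTo (suc K))                   ≡⟨ cong (concatMap f) (applyUpTo-∷ʳ (λ i → i) K) ⟨
  concatMap f (upTo K ∷ʳ K)                    ≡⟨ concatMap-++ f (upTo K) (K ∷ []) ⟩
  concatMap f (upTo K) ++ concatMap f (K ∷ []) ≡⟨ cong (concatMap f (upTo K) ++_) (++-identityʳ (f K)) ⟩
  concatMap f (upTo K) ++ f K                  ∎ where open ≡-Reasoning

Run-concatMap : ∀ {D} (f : ℕ → List ℕ) (g : ℕ → ℕ × ℕ) K →
                (∀ i → i < K → Run D (g i) (f i) (g (suc i))) →
                Run D (g 0) (concatMap f (upTo K)) (g K)
Run-concatMap f g zero    blocks = []
Run-concatMap {D} f g (suc K) blocks =
  subst (λ xs → Run D (g 0) xs (g (suc K))) (sym (concatMap-upTo-suc f K))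
    (Run-concatMap f g K (λ i i<K → blocks i (m<n⇒m<1+n i<K)) ++ᴿ blocks K ≤-refl)

Run-reverse-concatMap : ∀ {D} (f : ℕ → List ℕ) (g : ℕ → ℕ × ℕ) K →
                        (∀ i → i < K → Run D (g (suc i)) (reverse (f i)) (g i)) →
                        Run D (g K) (reverse (concatMap f (upTo K))) (g 0)
Run-reverse-concatMap f g zero    blocks = []
Run-reverse-concatMap {D} f g (suc K) blocks =
  subst (λ xs → Run D (g (suc K)) xs (g 0)) (sym reverse-split)
    (blocks K ≤-refl ++ᴿ Run-reverse-concatMap f g K (λ i i<K → blocks i (m<n⇒m<1+n i<K)))
  where
  reverse-split : reverse (concatMap f (upTo (suc K))) ≡ reverse (f K) ++ reverse (concatMap f (upTo K))
  reverse-split = trans (cong reverse (concatMap-upTo-suc f K)) (reverse-++ (concatMap f (upTo K)) (f K))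

-- Purely periodic expansions

module Cycle {D b z : ℕ} {bs : List ℕ} {σ σ′ : ℕ × ℕ}
             (σ₁ : state D 1 ≡ σ) (prefix : Run D σ (b ∷ bs) σ′) (last : Step D σ′ z σ) where

  block : List ℕ
  block = (b ∷ bs) ++ z ∷ []

  L : ℕ
  L = length block

  state-periodic : ∀ i → state D (suc i + L) ≡ state D (suc i)
  state-periodic zero    = trans (Run-state 1 σ₁ (prefix ++ᴿ last ∷ [])) (sym σ₁)
  state-periodic (suc i) = begin
    state D (suc (suc i + L))     ≡⟨ state-suc D (suc i + L) ⟩
    next D (state D (suc i + L))  ≡⟨ cong (next D) (state-periodic i) ⟩
    next D (state D (suc i))      ≡⟨ state-suc D (suc i) ⟨
    state D (suc (suc i))         ∎ where open ≡-Reasoning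

  isPeriod : IsPeriod D L
  isPeriod (suc i) _ = begin
    cfSqrt D (suc i + L)              ≡⟨ cfSqrt≡quotient D (suc i + L) ⟩
    quotient D (state D (suc i + L))  ≡⟨ cong (quotient D) (state-periodic i) ⟩
    quotient D (state D (suc i))      ≡⟨ cfSqrt≡quotient D (suc i) ⟨
    cfSqrt D (suc i)                  ∎ where open ≡-Reasoning

  cfSqrt-+*L : ∀ q i → cfSqrt D (suc (i + q * L)) ≡ cfSqrt D (suc i)
  cfSqrt-+*L zero    i = cong (λ j → cfSqrt D (suc j)) (+-identityʳ i)
  cfSqrt-+*L (suc q) i = begin
    cfSqrt D (suc (i + (L + q * L))) ≡⟨ cong (λ j → cfSqrt D (suc j)) regroup ⟩
    cfSqrt D (suc (i + q * L) + L)   ≡⟨ isPeriod (suc (i + q * L)) (s≤s z≤n) ⟩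
    cfSqrt D (suc (i + q * L))       ≡⟨ cfSqrt-+*L q i ⟩
    cfSqrt D (suc i)                 ∎
    where
    open ≡-Reasoning
    regroup : i + (L + q * L) ≡ i + q * L + L
    regroup = trans (cong (_+_ i) (+-comm L (q * L))) (sym (+-assoc i (q * L) L))

  expansion : ∀ i → cfSqrt D (suc i) ≡ lookupMod block i
  expansion i = begin
    cfSqrt D (suc i)                   ≡⟨ cong (λ j → cfSqrt D (suc j)) (m≡m%n+[m/n]*n i L) ⟩
    cfSqrt D (suc (i % L + i / L * L)) ≡⟨ cfSqrt-+*L (i / L) (i % L) ⟩
    cfSqrt D (suc (i % L))             ≡⟨ cong (λ j → cfSqrt D (suc j)) (toℕ-fromℕ< (m%n<n i L)) ⟨
    cfSqrt D (1 + toℕ j)               ≡⟨ Run-cfSqrt 1 σ₁ (prefix ++ᴿ last ∷ []) j ⟩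
    lookup block j                     ∎
    where
    open ≡-Reasoning
    j : Fin L
    j = fromℕ< (m%n<n i L)

  -- A period p < L would give the last partial quotient z the value at position L − p, below z.
  minimal : All (_< z) (b ∷ bs) → ∀ p → 1 ≤ p → IsPeriod D p → L ≤ p
  minimal below-z p 1≤p period = ≮⇒≥ p<L-impossible
    where
    M : ℕ
    M = length (b ∷ bs)
    L≡1+M : L ≡ suc M
    L≡1+M = trans (length-++ (b ∷ bs)) (+-comm M 1)
    p<L-impossible : ¬ p < L
    p<L-impossible p<L = <-irrefl refl (begin-strict
      z                                ≡⟨ Step-cfSqrt (1 + M) (Run-state 1 σ₁ prefix) last ⟨
      cfSqrt D (1 + M)                 ≡⟨ cong (cfSqrt D) (cong suc (m∸n+n≡m p≤M)) ⟨
      cfSqrt D (suc j + p)             ≡⟨ period (suc j) (s≤s z≤n) ⟩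
      cfSqrt D (suc j)                 ≡⟨ cong (λ x → cfSqrt D (suc x)) (toℕ-fromℕ< j<M) ⟨
      cfSqrt D (1 + toℕ (fromℕ< j<M))  ≡⟨ Run-cfSqrt 1 σ₁ prefix (fromℕ< j<M) ⟩
      lookup (b ∷ bs) (fromℕ< j<M)     <⟨ All.lookup below-z (∈-lookup (fromℕ< j<M)) ⟩
      z                                ∎)
      where
      open ≤-Reasoning
      p≤M : p ≤ M
      p≤M = ≤-pred (subst (p <_) L≡1+M p<L)
      j : ℕ
      j = M ∸ p
      j<M : j < M
      j<M = ∸-monoʳ-< 1≤p p≤M

  periodLength : All (_< z) (b ∷ bs) → PeriodLength D L
  periodLength below-z = s≤s z≤n , isPeriod , minimal below-z

-- Square roots of N² + r

N*N+r<[1+N]² : ∀ {N r} → r ≤ N + N → N * N + r < suc N * suc N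
N*N+r<[1+N]² {N} {r} r≤N+N = begin-strict
  N * N + r              ≤⟨ +-monoʳ-≤ (N * N) r≤N+N ⟩
  N * N + (N + N)        <⟨ n<1+n _ ⟩
  suc (N * N + (N + N))  ≡⟨ solve (N ∷ []) ⟩
  suc N * suc N          ∎ where open ≤-Reasoning

between-squares⇒nonSquare : ∀ {N D} → N * N < D → D < suc N * suc N → NonSquare D
between-squares⇒nonSquare {N} N²<D D<[1+N]² (x , x²≡D) with x ≤? N
... | yes x≤N = <⇒≱ N²<D (subst (_≤ N * N) x²≡D (*-mono-≤ x≤N x≤N))
... | no  x≰N = <⇒≱ D<[1+N]² (subst (suc N * suc N ≤_) x²≡D (*-mono-≤ N<x N<x))
  where
  N<x : N < x
  N<x = ≰⇒> x≰N

half-≤ : ∀ {m n} → m + m ≤ n + n → m ≤ n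
half-≤ {m} {n} m+m≤n+n = ≮⇒≥ (λ n<m → <⇒≱ (+-mono-< n<m n<m) m+m≤n+n)

pos-∸ : ∀ {m n} → n ≤ m → + (m ∸ n) ≡ + m ℤ.- + n
pos-∸ {m} {n} n≤m = sym (trans (ℤ.m-n≡m⊖n m n) (ℤ.⊖-≥ n≤m))

module NearSquare (n r : ℕ) (0<r : 0 < r) (r≤N+N : r ≤ (n + 1) + (n + 1)) where

  N : ℕ
  N = n + 1

  D : ℕ
  D = N * N + r

  T : ℕ
  T = n + N + r

  open FloorSqrt {D} {N} (m≤m+n (N * N) r) (N*N+r<[1+N]² {N} r≤N+N)

  α β : ℕ → ℕ × ℕ
  α q = N + r ∸ q , q
  β q = n , q

  μ : ℕ → ℕ → ℕ × ℕ
  μ q v = N + r ∸ q , (q ∸ r) * (v ∸ 1) + 1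

  T≤[N+r]+[N+r] : T ≤ (N + r) + (N + r)
  T≤[N+r]+[N+r] = begin
    n + N + r          ≡⟨ +-assoc n N r ⟩
    n + (N + r)        ≤⟨ +-monoˡ-≤ (N + r) (≤-trans (m≤m+n n 1) (m≤m+n N r)) ⟩
    (N + r) + (N + r)  ∎ where open ≤-Reasoning

  twice≤T⇒≤N+r : ∀ {x} → x + x ≤ T → x ≤ N + r
  twice≤T⇒≤N+r x+x≤T = half-≤ (≤-trans x+x≤T T≤[N+r]+[N+r])

  cofactor≤N+r : ∀ q {p} → q * p ≡ T → 2 ≤ p → q ≤ N + r
  cofactor≤N+r q {p} qp≡T 2≤p = twice≤T⇒≤N+r (begin
    q + q  ≡⟨ solve (q ∷ []) ⟩
    q * 2  ≤⟨ *-monoʳ-≤ q 2≤p ⟩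
    q * p  ≡⟨ qp≡T ⟩
    T      ∎) where open ≤-Reasoning

  r-image : ∀ q v → q * v ≡ T → + r ≡ + q ℤ.* + v ℤ.- + n ℤ.- + n ℤ.- 1ℤ
  r-image q v qv≡T = solve-for-r (trans (sym (ℤ.pos-* q v)) (cong +_ qv≡T))

  μ-denominator-image : ∀ {q v} → r ≤ q → 1 ≤ v →
                        + ((q ∸ r) * (v ∸ 1) + 1) ≡ (+ q ℤ.- + r) ℤ.* (+ v ℤ.- 1ℤ) ℤ.+ 1ℤ
  μ-denominator-image {q} {v} r≤q 1≤v =
    cong (ℤ._+ 1ℤ) (trans (ℤ.pos-* (q ∸ r) (v ∸ 1)) (cong₂ ℤ._*_ (pos-∸ r≤q) (pos-∸ 1≤v)))

  step-via-ℤ : ∀ {P Q a P′ Q′} → + P′ ℤ.+ + P ≡ + a ℤ.* + Q → P′ ≤ N → N < P′ + Q →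
               + P′ ℤ.* + P′ ℤ.+ + Q′ ℤ.* + Q ≡ + N ℤ.* + N ℤ.+ + r → Step D (P , Q) a (P′ , Q′)
  step-via-ℤ {P} {Q} {a} {P′} {Q′} sum P′≤N N<P′+Q norm =
    step (ℤ.+-injective (trans sum (sym (ℤ.pos-* a Q)))) P′≤N N<P′+Q (ℤ.+-injective (begin
      + (P′ * P′) ℤ.+ + (Q′ * Q)      ≡⟨ cong₂ ℤ._+_ (ℤ.pos-* P′ P′) (ℤ.pos-* Q′ Q) ⟩
      + P′ ℤ.* + P′ ℤ.+ + Q′ ℤ.* + Q  ≡⟨ norm ⟩
      + N ℤ.* + N ℤ.+ + r             ≡⟨ cong (ℤ._+ + r) (ℤ.pos-* N N) ⟨
      + (N * N) ℤ.+ + r               ∎))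
    where open ≡-Reasoning

  unit-step : ∀ P → Step D (P , 1) (P + N) (N , r)
  unit-step P = step (trans (+-comm N P) (sym (*-identityʳ (P + N)))) ≤-refl (m<m+n N z<s)
                     (cong (_+_ (N * N)) (*-identityʳ r))

  α-step : ∀ {q p} → q * p ≡ T → 2 ≤ q → 2 ≤ p → Step D (α q) (p ∸ 1) (β p)
  α-step {q} {p} qp≡T 2≤q 2≤p =
    step-via-ℤ (sum-identity (+ n) (+ q) (+ p) (r-image q p qp≡T) P-image (pos-∸ (≤-trans (n≤1+n 1) 2≤p)))
               (m≤m+n n 1) (+-monoʳ-< n 2≤q) (norm-identity (+ n) (+ q) (+ p) (r-image q p qp≡T))
    where
    P-image : + (N + r ∸ q) ≡ + (N + r) ℤ.- + q
    P-image = pos-∸ (cofactor≤N+r q qp≡T 2≤p)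

  β-step : ∀ {q v} → q * v ≡ T → r ≤ q → 2 ≤ v → Step D (β q) (v ∸ 1) (μ q v)
  β-step {q} {v} qv≡T r≤q 2≤v =
    step-via-ℤ (trans (ℤ.+-comm (+ (N + r ∸ q)) (+ n)) (sum-identity (+ n) (+ q) (+ v) r≡ P′-image (pos-∸ 1≤v)))
               (≤-trans (∸-monoʳ-≤ (N + r) r≤q) (≤-reflexive (m+n∸n≡m N r)))
               (<-≤-trans (m<m+n N 0<r) (≤-reflexive (sym (m∸n+n≡m (cofactor≤N+r q qv≡T 2≤v)))))
               (β-norm-identity (+ n) (+ q) (+ v) r≡ P′-image (μ-denominator-image r≤q 1≤v))
    where
    r≡ : + r ≡ + q ℤ.* + v ℤ.- + n ℤ.- + n ℤ.- 1ℤ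
    r≡ = r-image q v qv≡T
    1≤v : 1 ≤ v
    1≤v = ≤-trans (n≤1+n 1) 2≤v
    P′-image : + (N + r ∸ q) ≡ + (N + r) ℤ.- + q
    P′-image = pos-∸ (cofactor≤N+r q qv≡T 2≤v)

  μ-step : ∀ {q v} → q * v ≡ T → r + r ≤ q → 2 ≤ v → Step D (μ q v) 1 (α (r * v))
  μ-step {q} {v} qv≡T 2r≤q 2≤v =
    step-via-ℤ (μ-sum-identity (+ n) (+ q) (+ v) r≡ (ℤ.pos-* r v) P′-image P-image Q-image)
               (≤-trans (∸-monoʳ-≤ (N + r) (m≤m*n r v {{>-nonZero 1≤v}})) (≤-reflexive (m+n∸n≡m N r)))
               (≤-trans (m≤m+n (suc N) w) (≤-reflexive (sym gap)))
               (μ-norm-identity (+ n) (+ q) (+ v) r≡ (ℤ.pos-* r v) P′-image Q-image)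
    where
    r≡ : + r ≡ + q ℤ.* + v ℤ.- + n ℤ.- + n ℤ.- 1ℤ
    r≡ = r-image q v qv≡T
    1≤v : 1 ≤ v
    1≤v = ≤-trans (n≤1+n 1) 2≤v
    r≤q : r ≤ q
    r≤q = ≤-trans (m≤m+n r r) 2r≤q
    rv≤N+r : r * v ≤ N + r
    rv≤N+r = twice≤T⇒≤N+r (begin
      r * v + r * v ≡⟨ *-distribʳ-+ v r r ⟨
      (r + r) * v   ≤⟨ *-monoˡ-≤ v 2r≤q ⟩
      q * v         ≡⟨ qv≡T ⟩
      T             ∎) where open ≤-Reasoning
    P′-image : + (N + r ∸ r * v) ≡ + (N + r) ℤ.- + (r * v)
    P′-image = pos-∸ rv≤N+r
    P-image : + (N + r ∸ q) ≡ + (N + r) ℤ.- + q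
    P-image = pos-∸ (cofactor≤N+r q qv≡T 2≤v)
    Q-image : + ((q ∸ r) * (v ∸ 1) + 1) ≡ (+ q ℤ.- + r) ℤ.* (+ v ℤ.- 1ℤ) ℤ.+ 1ℤ
    Q-image = μ-denominator-image r≤q 1≤v
    w : ℕ
    w = (v ∸ 1) * (q ∸ (r + r))
    gap : N + r ∸ r * v + ((q ∸ r) * (v ∸ 1) + 1) ≡ suc N + w
    gap = ℤ.+-injective (μ-gap-identity (+ n) (+ q) (+ v) (+ r) (ℤ.pos-* r v) P′-image Q-image
                          (trans (ℤ.pos-* (v ∸ 1) (q ∸ (r + r))) (cong₂ ℤ._*_ (pos-∸ 1≤v) (pos-∸ 2r≤q))))

  β-turn : ∀ {q a p} → q * a ≡ n + n → q * p ≡ T → 2 ≤ q → Step D (β q) a (β p)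
  β-turn {q} {a} {p} qa≡2n qp≡T 2≤q =
    step-via-ℤ (trans (cong +_ (trans (sym qa≡2n) (*-comm q a))) (ℤ.pos-* a q))
               (m≤m+n n 1) (+-monoʳ-< n 2≤q) (norm-identity (+ n) (+ q) (+ p) (r-image q p qp≡T))

  zigzag : ∀ {u v} → r * u * v ≡ T → 2 ≤ u → 2 ≤ v → Run D (β (r * u)) (v ∸ 1 ∷ 1 ∷ u ∸ 1 ∷ []) (β u)
  zigzag {u} {v} ruv≡T 2≤u 2≤v =
    β-step ruv≡T (≤-trans (m≤m+n r r) 2r≤ru) 2≤v ∷ μ-step ruv≡T 2r≤ru 2≤v ∷ α-step rvu≡T 2≤rv 2≤u ∷ []
    where
    2r≤ru : r + r ≤ r * u
    2r≤ru = ≤-trans (≤-reflexive (solve (r ∷ []))) (*-monoʳ-≤ r 2≤u)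
    rvu≡T : r * v * u ≡ T
    rvu≡T = trans (xy∙z≈xz∙y r v u) ruv≡T
    2≤rv : 2 ≤ r * v
    2≤rv = ≤-trans 2≤v (m≤n*m v r {{>-nonZero 0<r}})

  pred-cofactor<N+N : ∀ q {p} → q * p ≡ T → 2 ≤ q → p ∸ 1 < N + N
  pred-cofactor<N+N q {p} qp≡T 2≤q = pred< {p} (half-≤ (begin
    p + p               ≡⟨ solve (p ∷ []) ⟩
    2 * p               ≤⟨ *-monoˡ-≤ p 2≤q ⟩
    q * p               ≡⟨ qp≡T ⟩
    n + N + r           ≤⟨ +-mono-≤ (+-monoˡ-≤ N (m≤m+n n 1)) r≤N+N ⟩
    (N + N) + (N + N)   ∎))
    where
    open ≤-Reasoning
    pred< : ∀ {x} → x ≤ N + N → x ∸ 1 < N + N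
    pred< {zero}  _   = +-mono-≤ (m≤n+m 1 n) z≤n
    pred< {suc x} x<  = x<

All-reverse : ∀ {P : ℕ → Set} {xs} → All P xs → All P (reverse xs)
All-reverse {xs = []}     All.[]         = All.[]
All-reverse {xs = x ∷ xs} (px All.∷ pxs) = subst (All _) (sym (unfold-reverse x xs)) (∷ʳ⁺ (All-reverse pxs) px)

length-concatMap : ∀ (f : ℕ → List ℕ) {c} xs → (∀ x → length (f x) ≡ c) → length (concatMap f xs) ≡ length xs * c
length-concatMap f []       _     = refl
length-concatMap f (x ∷ xs) len-f =
  trans (length-++ (f x)) (cong₂ _+_ (len-f x) (length-concatMap f xs len-f))

module Family (m s K : ℕ) (1≤m : 1 ≤ m) (1≤s : 1 ≤ s) (1<ms : 1 < m * s) where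

  r R A n : ℕ
  r = rOf m s
  R = r ^ suc K
  A = R ∸ s
  n = m * A

  4≤2ms : 4 ≤ 2 * m * s
  4≤2ms = ≤-trans (*-monoʳ-≤ 2 1<ms) (≤-reflexive (sym (*-assoc 2 m s)))

  r+1≡2ms : r + 1 ≡ 2 * m * s
  r+1≡2ms = m∸n+n≡m (≤-trans (s≤s z≤n) 4≤2ms)

  3≤r : 3 ≤ r
  3≤r = ∸-monoˡ-≤ 1 4≤2ms

  0<r : 0 < r
  0<r = ≤-trans (s≤s z≤n) 3≤r

  2≤r : 2 ≤ r
  2≤r = ≤-trans (n≤1+n 2) 3≤r

  r≤r^suc : ∀ i → r ≤ r ^ suc i
  r≤r^suc i = m≤m*n r (r ^ i) {{m^n≢0 r i {{>-nonZero 0<r}}}}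

  2≤r^suc : ∀ i → 2 ≤ r ^ suc i
  2≤r^suc i = ≤-trans 2≤r (r≤r^suc i)

  2≤2mr^ : ∀ e → 2 ≤ 2 * m * r ^ e
  2≤2mr^ e = ≤-trans (*-monoʳ-≤ 2 1≤m) (m≤m*n (2 * m) (r ^ e) {{m^n≢0 r e {{>-nonZero 0<r}}}})

  s≤R : s ≤ R
  s≤R = ≤-trans s≤r (r≤r^suc K)
    where
    s≤r : s ≤ r
    s≤r = +-cancelʳ-≤ 1 s r (begin
      s + 1      ≤⟨ +-monoʳ-≤ s 1≤s ⟩
      s + s      ≡⟨ solve (s ∷ []) ⟩
      2 * 1 * s  ≤⟨ *-monoˡ-≤ s (*-monoʳ-≤ 2 1≤m) ⟩
      2 * m * s  ≡⟨ r+1≡2ms ⟨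
      r + 1      ∎) where open ≤-Reasoning

  A+s≡R : A + s ≡ R
  A+s≡R = m∸n+n≡m s≤R

  2mR≡2n+1+r : 2 * m * R ≡ n + (n + 1) + r
  2mR≡2n+1+r = begin
    2 * m * R              ≡⟨ cong (2 * m *_) A+s≡R ⟨
    2 * m * (A + s)        ≡⟨ *-distribˡ-+ (2 * m) A s ⟩
    2 * m * A + 2 * m * s  ≡⟨ cong (_+_ (2 * m * A)) r+1≡2ms ⟨
    2 * m * A + (r + 1)    ≡⟨ regroup m A r ⟩
    n + (n + 1) + r        ∎
    where
    open ≡-Reasoning
    regroup : ∀ m A r → 2 * m * A + (r + 1) ≡ m * A + (m * A + 1) + r
    regroup = solve-∀

  DOf≡ : DOf m s (suc K) ≡ (n + 1) * (n + 1) + r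
  DOf≡ = begin
    m * (2 * R + m * (A * A))                  ≡⟨ cong (λ x → m * (2 * x + m * (A * A))) A+s≡R ⟨
    m * (2 * (A + s) + m * (A * A))            ≡⟨ expand m A s ⟩
    n * n + 2 * n + 2 * m * s                  ≡⟨ cong (_+_ (n * n + 2 * n)) r+1≡2ms ⟨
    n * n + 2 * n + (r + 1)                    ≡⟨ complete-square n r ⟩
    (n + 1) * (n + 1) + r                      ∎
    where
    open ≡-Reasoning
    expand : ∀ m A s → m * (2 * (A + s) + m * (A * A)) ≡ m * A * (m * A) + 2 * (m * A) + 2 * m * s
    expand = solve-∀
    complete-square : ∀ x r → x * x + 2 * x + (r + 1) ≡ (x + 1) * (x + 1) + r
    complete-square = solve-∀

  r≤N+N : r ≤ (n + 1) + (n + 1)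
  r≤N+N = +-cancelʳ-≤ r r ((n + 1) + (n + 1)) (begin
    r + r                   ≤⟨ +-mono-≤ (r≤r^suc K) (r≤r^suc K) ⟩
    R + R                   ≡⟨ cong (_+_ R) (+-identityʳ R) ⟨
    2 * R                   ≤⟨ *-monoˡ-≤ R (*-monoʳ-≤ 2 1≤m) ⟩
    2 * m * R               ≡⟨ 2mR≡2n+1+r ⟩
    n + (n + 1) + r         ≤⟨ +-monoˡ-≤ r (+-monoˡ-≤ (n + 1) (m≤m+n n 1)) ⟩
    (n + 1) + (n + 1) + r   ∎) where open ≤-Reasoning

  open NearSquare n r 0<r r≤N+N

  T-split : ∀ i j → i + j ≡ K → r ^ suc i * (2 * m * r ^ j) ≡ T
  T-split i j i+j≡K = begin
    r ^ suc i * (2 * m * r ^ j)  ≡⟨ x∙yz≈y∙xz (r ^ suc i) (2 * m) (r ^ j) ⟩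
    2 * m * (r ^ suc i * r ^ j)  ≡⟨ cong (2 * m *_) (^-distribˡ-+-* r (suc i) j) ⟨
    2 * m * r ^ (suc i + j)      ≡⟨ cong (λ e → 2 * m * r ^ suc e) i+j≡K ⟩
    2 * m * R                    ≡⟨ 2mR≡2n+1+r ⟩
    T                            ∎ where open ≡-Reasoning

  r*2mr^K≡T : r * (2 * m * r ^ K) ≡ T
  r*2mr^K≡T = trans (cong (_* (2 * m * r ^ K)) (sym (*-identityʳ r))) (T-split 0 K refl)

  T-split-forward : ∀ i → i < K → r * (2 * m * r ^ (K ∸ suc i)) * r ^ suc i ≡ T
  T-split-forward i i<K =
    trans (xy∙z≈xz∙y r (2 * m * r ^ (K ∸ suc i)) (r ^ suc i)) (T-split (suc i) (K ∸ suc i) (m+[n∸m]≡n i<K))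

  triple : ℕ → List ℕ
  triple j = (r ^ j ∸ 1) ∷ 1 ∷ (2 * m * r ^ (K ∸ j) ∸ 1) ∷ []

  c₁ : ℕ
  c₁ = 2 * m * r ^ K ∸ 1

  rest : List ℕ
  rest = concatMap triple (map suc (upTo K))

  forward : Run D (β (2 * m * r ^ K)) rest (β (2 * m * r ^ 0))
  forward = subst₂ (Run D (β (2 * m * r ^ K))) (sym (concatMap-map triple suc (upTo K)))
                   (cong (λ e → β (2 * m * r ^ e)) (n∸n≡0 K))
                   (Run-concatMap (λ i → triple (suc i)) (λ i → β (2 * m * r ^ (K ∸ i))) K block)
    where
    block : ∀ i → i < K → Run D (β (2 * m * r ^ (K ∸ i))) (triple (suc i)) (β (2 * m * r ^ (K ∸ suc i)))
    block i i<K = subst (λ q → Run D (β q) (triple (suc i)) (β (2 * m * r ^ (K ∸ suc i)))) r*u≡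
                        (zigzag (T-split-forward i i<K) (2≤2mr^ (K ∸ suc i)) (2≤r^suc i))
      where
      r*u≡ : r * (2 * m * r ^ (K ∸ suc i)) ≡ 2 * m * r ^ (K ∸ i)
      r*u≡ = trans (x∙yz≈y∙xz r (2 * m) (r ^ (K ∸ suc i))) (cong (λ e → 2 * m * r ^ e) (sym (+-∸-assoc 1 i<K)))

  turn : Step D (β (2 * m * r ^ 0)) A (β R)
  turn = β-turn (twice m A) (trans (*-comm (2 * m * 1) R) (T-split K 0 (+-identityʳ K))) (2≤2mr^ 0)
    where
    twice : ∀ m A → 2 * m * 1 * A ≡ m * A + m * A
    twice = solve-∀

  backward : Run D (β R) (reverse rest) (β r)
  backward = subst₂ (Run D (β R)) (cong reverse (sym (concatMap-map triple suc (upTo K))))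
                    (cong β (*-identityʳ r))
                    (Run-reverse-concatMap (λ i → triple (suc i)) (λ i → β (r ^ suc i)) K block)
    where
    block : ∀ i → i < K → Run D (β (r ^ suc (suc i))) (reverse (triple (suc i))) (β (r ^ suc i))
    block i i<K = zigzag (T-split (suc i) (K ∸ suc i) (m+[n∸m]≡n i<K)) (2≤r^suc i) (2≤2mr^ (K ∸ suc i))

  N+r∸r≡N : N + r ∸ r ≡ N
  N+r∸r≡N = m+n∸n≡m N r

  first : Step D (N , r) c₁ (β (2 * m * r ^ K))
  first = subst (λ σ → Step D σ c₁ (β (2 * m * r ^ K))) (cong (_, r) N+r∸r≡N)
                (α-step r*2mr^K≡T 2≤r (2≤2mr^ K))

  to-unit : Step D (β r) c₁ (N , 1)
  to-unit = subst (Step D (β r) c₁) (cong₂ _,_ N+r∸r≡N (cong (λ x → x * (2 * m * r ^ K ∸ 1) + 1) (n∸n≡0 r)))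
                  (β-step r*2mr^K≡T ≤-refl (2≤2mr^ K))

  N+N≡2mA+2 : N + N ≡ 2 * m * A + 2
  N+N≡2mA+2 = double m A
    where
    double : ∀ m A → m * A + 1 + (m * A + 1) ≡ 2 * m * A + 2
    double = solve-∀

  last : Step D (N , 1) (2 * m * A + 2) (N , r)
  last = subst (λ a → Step D (N , 1) a (N , r)) N+N≡2mA+2 (unit-step N)

  cS : List ℕ
  cS = cSeq m s (suc K)

  prefix : Run D (N , r) (cS ++ A ∷ reverse cS) (N , 1)
  prefix = first ∷ forward ++ᴿ turn ∷ subst (λ xs → Run D (β R) xs (N , 1)) (sym (unfold-reverse c₁ rest))
                                             (backward ++ᴿ to-unit ∷ [])

  state₁ : state D 1 ≡ (N , r)
  state₁ = Step-state {D} 0 refl (unit-step 0)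

  open Cycle state₁ prefix last

  block≡blockOf : block ≡ blockOf m s (suc K)
  block≡blockOf = ++-assoc cS (A ∷ reverse cS) (2 * m * A + 2 ∷ [])

  L≡6k∸2 : L ≡ 6 * suc K ∸ 2
  L≡6k∸2 = begin
    length ((cS ++ A ∷ reverse cS) ++ 2 * m * A + 2 ∷ [])  ≡⟨ length-++ (cS ++ A ∷ reverse cS) ⟩
    length (cS ++ A ∷ reverse cS) + 1                      ≡⟨ cong (λ x → x + 1) (length-++ cS) ⟩
    length cS + suc (length (reverse cS)) + 1              ≡⟨ cong (λ x → length cS + suc x + 1) (length-reverse cS) ⟩
    length cS + suc (length cS) + 1                        ≡⟨ cong (λ x → x + suc x + 1) length-cS ⟩
    suc (K * 3) + suc (suc (K * 3)) + 1                    ≡⟨ m+n∸n≡m _ 2 ⟨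
    suc (K * 3) + suc (suc (K * 3)) + 1 + 2 ∸ 2            ≡⟨ cong (λ x → x ∸ 2) (six-k K) ⟩
    6 * suc K ∸ 2                                          ∎
    where
    open ≡-Reasoning
    length-cS : length cS ≡ suc (K * 3)
    length-cS = cong suc (begin
      length rest                           ≡⟨ length-concatMap triple (map suc (upTo K)) (λ _ → refl) ⟩
      length (map suc (upTo K)) * 3         ≡⟨ cong (λ x → x * 3) (trans (length-map suc (upTo K)) (length-applyUpTo (λ i → i) K)) ⟩
      K * 3                                 ∎)
    six-k : ∀ K → suc (K * 3) + suc (suc (K * 3)) + 1 + 2 ≡ 6 * suc K
    six-k = solve-∀

  below-last : All (_< 2 * m * A + 2) (cS ++ A ∷ reverse cS)
  below-last = All.map (λ x<N+N → <-≤-trans x<N+N (≤-reflexive N+N≡2mA+2)) (++⁺ cS-bound (A<N+N All.∷ All-reverse cS-bound))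
    where
    A<N+N : A < N + N
    A<N+N = ≤-trans (s≤s (m≤n*m A m {{>-nonZero 1≤m}})) (≤-trans (≤-reflexive (+-comm 1 n)) (m≤m+n N N))
    1<N+N : 1 < N + N
    1<N+N = +-mono-≤ (m≤n+m 1 n) (m≤n+m 1 n)
    triple-bound : ∀ {i} → i < K → All (_< N + N) (triple (suc i))
    triple-bound {i} i<K =
      pred-cofactor<N+N (r * u) (T-split-forward i i<K) (≤-trans (2≤2mr^ e) (m≤n*m u r {{>-nonZero 0<r}})) All.∷
      1<N+N All.∷
      pred-cofactor<N+N (r ^ suc (suc i)) (T-split (suc i) e (m+[n∸m]≡n i<K)) (2≤r^suc (suc i)) All.∷ All.[]
      where
      e u : ℕ
      e = K ∸ suc i
      u = 2 * m * r ^ e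
    cS-bound : All (_< N + N) cS
    cS-bound = pred-cofactor<N+N r r*2mr^K≡T 2≤r All.∷
               concat⁺ (map⁺ (map⁺ (applyUpTo⁺₁ (λ i → i) K triple-bound)))

  D≡DOf : D ≡ DOf m s (suc K)
  D≡DOf = sym DOf≡

  isNonSquare : NonSquare D
  isNonSquare = between-squares⇒nonSquare {N} (m<m+n (N * N) 0<r) (N*N+r<[1+N]² {N} r≤N+N)

  hasPeriodLength : PeriodLength D (6 * suc K ∸ 2)
  hasPeriodLength = subst (PeriodLength D) L≡6k∸2 (periodLength below-last)

  hasExpansion : HasExpansion D (m * A + 1) (blockOf m s (suc K))
  hasExpansion = Step-cfSqrt {D} 0 refl (unit-step 0) , s≤s z≤n ,
                 subst (λ b → ∀ i → cfSqrt D (suc i) ≡ lookupMod b i) block≡blockOf expansion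

corollary1 : (m s k : ℕ) → 1 ≤ m → 1 ≤ s → 1 ≤ k → 1 < m * s →
    NonSquare (DOf m s k) ×
    PeriodLength (DOf m s k) (6 * k ∸ 2) ×
    HasExpansion (DOf m s k) (m * (rOf m s ^ k ∸ s) + 1) (blockOf m s k)
corollary1 m s zero    _   _   ()  _
corollary1 m s (suc K) 1≤m 1≤s _   1<ms =
  subst (λ D → NonSquare D × PeriodLength D (6 * suc K ∸ 2) × HasExpansion D (m * A + 1) (blockOf m s (suc K)))
        D≡DOf (isNonSquare , hasPeriodLength , hasExpansion)
  where open Family m s K 1≤m 1≤s 1<ms
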